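{- For every integer $n\geq 3$, let $W_n$ be the wheel of order $n+1$ (a cycle $C_n$ together with one extra vertex adjacent to all vertices of the cycle). Then $\alpha_{mix}(W_n)=\lceil \frac{2n}{3}\rceil$.
   Context: All graphs are finite, simple and undirected. For a graph $G=(V,E)$, a mixed independent set of $G$ is a subset of $V\cup E$ in which no two objects are adjacent (two vertices joined by an edge, or two edges sharing an endpoint) or incident (a vertex and an edge containing it). The mixed independence number $\alpha_{mix}(G)$ is the largest cardinality of a mixed independent set of $G$. Equivalently, $\alpha_{mix}(G)=\alpha(T(G))$, where the total graph $T(G)$ has vertex set $V\cup E$, two elements being adjacent in $T(G)$ iff they are adjacent or incident in $G$. -}

module Defs where

open import Data.Nat using (ℕ; zero; suc; _+_; _*_; _≤_; NonZero)
open import Data.Nat.DivMod using (_%_; _/_)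
open import Data.Fin using (Fin; toℕ) renaming (zero to fz; suc to fs; _<_ to _<ᶠ_)
open import Data.List using (List; length)
open import Data.List.Relation.Unary.AllPairs using (AllPairs)
open import Data.Product using (Σ; _×_)
open import Data.Sum using (_⊎_)
open import Data.Unit using (⊤)
open import Data.Empty using (⊥)
open import Relation.Binary.PropositionalEquality using (_≡_)
open import Relation.Nullary using (¬_)

-- A graph on vertex set Fin m is given by its (symmetric, irreflexive) adjacency relation.

-- Elements of V ∪ E.  An edge {u,v} is represented once, by its endpoints u < v.
data MElem {m : ℕ} (Adj : Fin m → Fin m → Set) : Set where
  vtx : Fin m → MElem Adj
  edg : (u v : Fin m) → u <ᶠ v → Adj u v → MElem Adj

-- Conflict x y : x and y are the same object, or adjacent, or incident
-- (i.e. equal or adjacent in the total graph T(G)).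
Conflict : {m : ℕ} {Adj : Fin m → Fin m → Set} → MElem Adj → MElem Adj → Set
Conflict {Adj = Adj} (vtx u) (vtx v) = u ≡ v ⊎ Adj u v
Conflict (vtx w) (edg u v _ _) = w ≡ u ⊎ w ≡ v
Conflict (edg u v _ _) (vtx w) = w ≡ u ⊎ w ≡ v
Conflict (edg a b _ _) (edg c d _ _) = (a ≡ c ⊎ a ≡ d) ⊎ (b ≡ c ⊎ b ≡ d)

IsMixedIndep : {m : ℕ} {Adj : Fin m → Fin m → Set} → List (MElem Adj) → Set
IsMixedIndep = AllPairs (λ x y → ¬ Conflict x y)

MixedIndepNumberIs : {m : ℕ} → (Fin m → Fin m → Set) → ℕ → Set
MixedIndepNumberIs Adj k =
  Σ (List (MElem Adj)) (λ L → IsMixedIndep L × length L ≡ k)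
  × ((L : List (MElem Adj)) → IsMixedIndep L → length L ≤ k)

-- Cycle C_n on Fin n : i ~ j iff j ≡ i+1 (mod n) or i ≡ j+1 (mod n).
-- "j ≡ i+1 (mod n)" for i, j < n means: j = i+1, or (i = n-1 and j = 0).
Succ : (n : ℕ) → Fin n → Fin n → Set
Succ n i j = toℕ j ≡ suc (toℕ i) ⊎ (suc (toℕ i) ≡ n × toℕ j ≡ 0)

CycleAdj : (n : ℕ) → Fin n → Fin n → Set
CycleAdj n i j = Succ n i j ⊎ Succ n j i

-- Wheel W_n on Fin (suc n): vertex 0 is the hub, vertices 1..n form C_n.
WheelAdj : (n : ℕ) → Fin (suc n) → Fin (suc n) → Set
WheelAdj n fz fz = ⊥
WheelAdj n fz (fs j) = ⊤
WheelAdj n (fs i) fz = ⊤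
WheelAdj n (fs i) (fs j) = CycleAdj n i j

-- ⌈ a / 3 ⌉ = ⌊ (a + 2) / 3 ⌋
ceil3 : ℕ → ℕ
ceil3 a = (a + 2) / 3

-- Upper bound: a fractional clique cover of the total graph T(W_n).  If each member of a mixed
-- independent set L is assigned c distinct cliques of T(W_n) containing it, out of a family of N
-- cliques, then different members get disjoint assignments, so c·|L| ≤ N.  When the hub vertex
-- is not in L, take the n+1 stars (all objects containing a given vertex), the star of the hub a
-- second time, and the n closed rim edges {a, a+1, a(a+1)}: every rim vertex, spoke and rim edge
-- lies in three of them, so 3|L| ≤ 2n+2.  When the hub is in L, every other member is a rim edge;
-- the n rim stars and two copies of {hub} give 2|L| ≤ n+2, which is stronger as n ≥ 2.
-- Lower bound: give the rim objects positions, 2j for the vertex j and 2j+1 for the edge j(j+1).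
-- Rim objects at least three positions apart are compatible, so the spoke to vertex 0 together
-- with the rim objects at positions 2, 5, 8, … ≤ 2n−2 is mixed independent, of size ⌈2n/3⌉.

module Submission where

open import Defs
open import Data.Fin using (Fin; toℕ; fromℕ; fromℕ<; inject₁; lower₁)
  renaming (zero to fz; suc to fs)
import Data.Fin.Properties as Fin
open import Data.Fin.Properties using (+↔⊎)
open import Data.List using (List; []; _∷_; [_]; length; map; concatMap; lookup; tabulate)
open import Data.List.Membership.Propositional using (_∈_)
open import Data.List.Membership.Propositional.Properties using (∈-lookup; ∈-++⁻)
open import Data.List.Properties using (length-++; length-map; length-tabulate)
open import Data.List.Relation.Binary.Disjoint.Propositional using (Disjoint)
open import Data.List.Relation.Unary.All as All using (All; []; _∷_)
open import Data.List.Relation.Unary.Any using (here; there; any?)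
import Data.List.Relation.Unary.All.Properties as All
open import Data.List.Relation.Unary.AllPairs using (AllPairs; []; _∷_)
import Data.List.Relation.Unary.AllPairs.Properties as AllPairs
open import Data.List.Relation.Unary.Unique.Propositional using (Unique)
import Data.List.Relation.Unary.Unique.Propositional.Properties as Unique
open import Data.Nat using (ℕ; zero; suc; _+_; _*_; _≤_; _<_; z≤n; s≤s; _≤?_)
open import Data.Nat.Properties
open import Data.Nat.DivMod using (_/_; m*n/n≡m; /-monoˡ-≤; m/n*n≤m)
open import Data.Nat.Tactic.RingSolver using (solve; solve-∀)
open import Data.Product using (Σ; ∃; ∃₂; _×_; _,_; proj₁; proj₂)
open import Data.Sum using (_⊎_; inj₁; inj₂; swap)
open import Data.Sum.Properties using (inj₁-injective; inj₂-injective)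
open import Function.Bundles using (_↣_; Injection)
open import Function.Construct.Symmetry using (↔-sym)
open import Function.Properties.Inverse using (↔⇒↣)
open import Function.Base using (_∘_)
open import Relation.Binary.PropositionalEquality using (_≡_; _≢_; refl; sym; trans; cong; subst)
open import Relation.Nullary using (¬_; Dec; yes; no; contradiction)

Unique⇒lookup-injective : ∀ {A : Set} {xs : List A} → Unique xs →
                          ∀ {i j} → lookup xs i ≡ lookup xs j → i ≡ j
Unique⇒lookup-injective (_ ∷ _)   {fz}   {fz}   _  = refl
Unique⇒lookup-injective (x∉ ∷ _)  {fz}   {fs j} eq = contradiction eq (All.lookup x∉ (∈-lookup j))
Unique⇒lookup-injective (x∉ ∷ _)  {fs i} {fz}   eq = contradiction (sym eq) (All.lookup x∉ (∈-lookup i))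
Unique⇒lookup-injective (_ ∷ un)  {fs i} {fs j} eq = cong fs (Unique⇒lookup-injective un eq)

Unique⇒length≤ : ∀ {N} {xs : List (Fin N)} → Unique xs → length xs ≤ N
Unique⇒length≤ {N} {xs} un with length xs ≤? N
... | yes ≤N = ≤N
... | no ≰N =
  let i , j , i<j , eq = Fin.pigeonhole (≰⇒> ≰N) (lookup xs)
  in contradiction (Unique⇒lookup-injective un eq) (Fin.<⇒≢ i<j)

module CliqueCover {X S : Set} {N : ℕ} (code : S ↣ Fin N)
  {Clash : X → X → Set} {Clique : S → X → Set}
  (clique-clash : ∀ {s x y} → Clique s x → Clique s y → Clash x y)
  (slots : X → List S) where

  Covered : ℕ → X → Set
  Covered c x = Unique (slots x) × c ≤ length (slots x) × All (λ s → Clique s x) (slots x)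

  private
    disjoint : ∀ {c x L} → All (λ s → Clique s x) (slots x) → All (Covered c) L →
               All (λ y → ¬ Clash x y) L → Disjoint (slots x) (concatMap slots L)
    disjoint {L = y ∷ L} x∈ ((_ , _ , y∈) ∷ cov) (¬xy ∷ ¬xL) (s∈x , s∈yL)
      with ∈-++⁻ (slots y) s∈yL
    ... | inj₁ s∈y = ¬xy (clique-clash (All.lookup x∈ s∈x) (All.lookup y∈ s∈y))
    ... | inj₂ s∈L = disjoint x∈ cov ¬xL (s∈x , s∈L)

    unique : ∀ {c L} → All (Covered c) L → AllPairs (λ x y → ¬ Clash x y) L →
             Unique (concatMap slots L)
    unique [] [] = []
    unique ((un , _ , x∈) ∷ cov) (¬xL ∷ ¬LL) =
      Unique.++⁺ un (unique cov ¬LL) (disjoint x∈ cov ¬xL)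

    length≥ : ∀ {c L} → All (Covered c) L → c * length L ≤ length (concatMap slots L)
    length≥ {c} [] = ≤-reflexive (*-zeroʳ c)
    length≥ {c} {x ∷ L} ((_ , c≤ , _) ∷ cov) = begin
      c * suc (length L)                          ≡⟨ *-suc c (length L) ⟩
      c + c * length L                            ≤⟨ +-mono-≤ c≤ (length≥ cov) ⟩
      length (slots x) + length (concatMap slots L) ≡⟨ length-++ (slots x) ⟨
      length (concatMap slots (x ∷ L))            ∎
      where open ≤-Reasoning

  cover-bound : ∀ {c L} → All (Covered c) L → AllPairs (λ x y → ¬ Clash x y) L →
                c * length L ≤ N
  cover-bound {c} {L} cov indep = begin
    c * length L                          ≤⟨ length≥ cov ⟩
    length (concatMap slots L)            ≡⟨ length-map to (concatMap slots L) ⟨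
    length (map to (concatMap slots L))   ≤⟨ Unique⇒length≤ (Unique.map⁺ injective (unique cov indep)) ⟩
    N                                     ∎
    where open ≤-Reasoning
          open Injection code

module _ {m : ℕ} {Adj : Fin m → Fin m → Set} where

  infix 4 _∈V_
  _∈V_ : Fin m → MElem Adj → Set
  w ∈V vtx u       = w ≡ u
  w ∈V edg u v _ _ = w ≡ u ⊎ w ≡ v

  shared-vertex⇒Conflict : ∀ {w x y} → w ∈V x → w ∈V y → Conflict x y
  shared-vertex⇒Conflict {x = vtx _}       {vtx _}       refl refl = inj₁ refl
  shared-vertex⇒Conflict {x = vtx _}       {edg _ _ _ _} refl w∈y  = w∈y
  shared-vertex⇒Conflict {x = edg _ _ _ _} {vtx _}       w∈x  refl = w∈x
  shared-vertex⇒Conflict {x = edg _ _ _ _} {edg _ _ _ _} (inj₁ refl) w∈y = inj₁ w∈y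
  shared-vertex⇒Conflict {x = edg _ _ _ _} {edg _ _ _ _} (inj₂ refl) w∈y = inj₂ w∈y

  Conflict⇒shared⊎adjacent : ∀ {x y} → Conflict x y →
    (∃ λ w → w ∈V x × w ∈V y) ⊎ (∃₂ λ u v → x ≡ vtx u × y ≡ vtx v × Adj u v)
  Conflict⇒shared⊎adjacent {vtx u}       {vtx _}       (inj₁ refl) = inj₁ (u , refl , refl)
  Conflict⇒shared⊎adjacent {vtx u}       {vtx v}       (inj₂ uv)   = inj₂ (u , v , refl , refl , uv)
  Conflict⇒shared⊎adjacent {vtx u}       {edg _ _ _ _} u∈y         = inj₁ (u , refl , u∈y)
  Conflict⇒shared⊎adjacent {edg _ _ _ _} {vtx w}       w∈x         = inj₁ (w , w∈x , refl)
  Conflict⇒shared⊎adjacent {edg a _ _ _} {edg _ _ _ _} (inj₁ a∈y)  = inj₁ (a , inj₁ refl , a∈y)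
  Conflict⇒shared⊎adjacent {edg _ b _ _} {edg _ _ _ _} (inj₂ b∈y)  = inj₁ (b , inj₂ refl , b∈y)

  Conflict-sym : (∀ {u v} → Adj u v → Adj v u) → ∀ {x y} → Conflict x y → Conflict y x
  Conflict-sym adj-sym c with Conflict⇒shared⊎adjacent c
  ... | inj₁ (_ , w∈x , w∈y)              = shared-vertex⇒Conflict w∈y w∈x
  ... | inj₂ (_ , _ , refl , refl , uv)   = inj₂ (adj-sym uv)

  data WithinEdge (p q : Fin m) : MElem Adj → Set where
    endpoint : ∀ {w} → w ≡ p ⊎ w ≡ q → WithinEdge p q (vtx w)
    edge     : ∀ {x} → p ∈V x → q ∈V x → WithinEdge p q x

  WithinEdge⇒Conflict : ∀ {p q x y} → Adj p q → Adj q p →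
                        WithinEdge p q x → WithinEdge p q y → Conflict x y
  WithinEdge⇒Conflict _  _  (endpoint (inj₁ refl)) (endpoint (inj₁ refl)) = inj₁ refl
  WithinEdge⇒Conflict pq _  (endpoint (inj₁ refl)) (endpoint (inj₂ refl)) = inj₂ pq
  WithinEdge⇒Conflict _  qp (endpoint (inj₂ refl)) (endpoint (inj₁ refl)) = inj₂ qp
  WithinEdge⇒Conflict _  _  (endpoint (inj₂ refl)) (endpoint (inj₂ refl)) = inj₁ refl
  WithinEdge⇒Conflict _  _  (endpoint (inj₁ refl)) (edge p∈y _) = shared-vertex⇒Conflict refl p∈y
  WithinEdge⇒Conflict _  _  (endpoint (inj₂ refl)) (edge _ q∈y) = shared-vertex⇒Conflict refl q∈y
  WithinEdge⇒Conflict _  _  (edge p∈x _) (endpoint (inj₁ refl)) = shared-vertex⇒Conflict p∈x refl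
  WithinEdge⇒Conflict _  _  (edge _ q∈x) (endpoint (inj₂ refl)) = shared-vertex⇒Conflict q∈x refl
  WithinEdge⇒Conflict _  _  (edge p∈x _) (edge p∈y _)           = shared-vertex⇒Conflict p∈x p∈y

AllPairs-member : ∀ {A : Set} {R : A → A → Set} → (∀ {x y} → R x y → R y x) →
                  ∀ {x L} → AllPairs R L → x ∈ L → All (λ y → x ≡ y ⊎ R x y) L
AllPairs-member R-sym (Rx ∷ _)  (here refl) = inj₁ refl ∷ All.map inj₂ Rx
AllPairs-member R-sym (Ry ∷ RL) (there x∈L) =
  inj₂ (R-sym (All.lookup Ry x∈L)) ∷ AllPairs-member R-sym RL x∈L

next : ∀ {n} → Fin n → Fin n
next {suc m} i with m ≟ toℕ i
... | yes _   = fz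
... | no m≢i  = fs (lower₁ i m≢i)

prev : ∀ {n} → Fin n → Fin n
prev {suc m} fz     = fromℕ m
prev {suc m} (fs i) = inject₁ i

Succ-next : ∀ {n} i → Succ n i (next i)
Succ-next {suc m} i with m ≟ toℕ i
... | yes m≡i = inj₂ (cong suc (sym m≡i) , refl)
... | no m≢i  = inj₁ (cong suc (Fin.toℕ-lower₁ i m≢i))

Succ-prev : ∀ {n} i → Succ n (prev i) i
Succ-prev {suc m} fz     = inj₂ (cong suc (Fin.toℕ-fromℕ m) , refl)
Succ-prev {suc m} (fs i) = inj₁ (cong suc (sym (Fin.toℕ-inject₁ i)))

Succ-functional : ∀ {n a b c} → Succ n a b → Succ n a c → b ≡ c
Succ-functional (inj₁ b≡) (inj₁ c≡) = Fin.toℕ-injective (trans b≡ (sym c≡))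
Succ-functional {b = b} (inj₁ b≡) (inj₂ (a+1≡n , _)) =
  contradiction (trans b≡ a+1≡n) (<⇒≢ (Fin.toℕ<n b))
Succ-functional {c = c} (inj₂ (a+1≡n , _)) (inj₁ c≡) =
  contradiction (trans c≡ a+1≡n) (<⇒≢ (Fin.toℕ<n c))
Succ-functional (inj₂ (_ , b≡0)) (inj₂ (_ , c≡0)) = Fin.toℕ-injective (trans b≡0 (sym c≡0))

next-prev : ∀ {n} (i : Fin n) → next (prev i) ≡ i
next-prev {n} i = Succ-functional {n} {prev i} (Succ-next (prev i)) (Succ-prev i)

Succ⇒≢ : ∀ {n a b} → 2 ≤ n → Succ n a b → a ≢ b
Succ⇒≢ _ (inj₁ a≡1+a) refl = <-irrefl a≡1+a (n<1+n _)
Succ⇒≢ (s≤s (s≤s _)) (inj₂ (a+1≡n , a≡0)) refl with trans (cong suc (sym a≡0)) a+1≡n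
... | ()

ceil3-greatest : ∀ a {m} → 3 * m ≤ a + 2 → m ≤ ceil3 a
ceil3-greatest a {m} 3m≤ = begin
  m              ≡⟨ m*n/n≡m m 3 ⟨
  m * 3 / 3      ≤⟨ /-monoˡ-≤ 3 (subst (_≤ a + 2) (*-comm 3 m) 3m≤) ⟩
  (a + 2) / 3    ∎
  where open ≤-Reasoning

ceil3-sound : ∀ a → 3 * ceil3 a ≤ a + 2
ceil3-sound a = subst (_≤ a + 2) (*-comm (ceil3 a) 3) (m/n*n≤m (a + 2) 3)

ceil3-positive : ∀ {a} → 1 ≤ a → 1 ≤ ceil3 a
ceil3-positive 1≤a = /-monoˡ-≤ 3 (+-monoˡ-≤ 2 1≤a)

2*m≤n+2⇒3*m≤2*n+2 : ∀ {m n} → 2 ≤ n → 2 * m ≤ n + 2 → 3 * m ≤ 2 * n + 2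
2*m≤n+2⇒3*m≤2*n+2 {m} {n} 2≤n 2m≤ = *-cancelˡ-≤ 2 (+-cancelʳ-≤ 2 _ _ (begin
  2 * (3 * m) + 2       ≡⟨ solve [ m ] ⟩
  3 * (2 * m) + 2       ≤⟨ +-monoˡ-≤ 2 (*-monoʳ-≤ 3 2m≤) ⟩
  3 * (n + 2) + 2       ≤⟨ +-monoʳ-≤ (3 * (n + 2)) 2≤n ⟩
  3 * (n + 2) + n       ≡⟨ solve [ n ] ⟩
  2 * (2 * n + 2) + 2   ∎))
  where open ≤-Reasoning

suc+suc≡2*+2 : ∀ n → suc n + suc n ≡ 2 * n + 2
suc+suc≡2*+2 = solve-∀

data Half : ℕ → Set where
  even : ∀ j → Half (2 * j)
  odd  : ∀ j → Half (suc (2 * j))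

half : ∀ p → Half p
half zero = even 0
half (suc p) with half p
... | even j = odd j
... | odd j  = subst Half (*-suc 2 j) (even (suc j))

module Wheel (k : ℕ) where

  n : ℕ
  n = suc (suc k)

  E : Set
  E = MElem (WheelAdj n)

  2≤n : 2 ≤ n
  2≤n = s≤s (s≤s z≤n)

  hub : E
  hub = vtx fz

  WheelAdj-sym : ∀ {u v} → WheelAdj n u v → WheelAdj n v u
  WheelAdj-sym {fz}   {fs _} _ = _
  WheelAdj-sym {fs _} {fz}   _ = _
  WheelAdj-sym {fs _} {fs _} uv = swap uv

  hub? : (x : E) → Dec (hub ≡ x)
  hub? (vtx fz)      = yes refl
  hub? (vtx (fs _))  = no λ ()
  hub? (edg _ _ _ _) = no λ ()

  Slot₁ : Set
  Slot₁ = Fin (suc n) ⊎ Fin (suc n)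

  pattern star w = inj₁ w
  pattern spoke  = inj₂ fz
  pattern rim a  = inj₂ (fs a)

  Clique₁ : Slot₁ → E → Set
  Clique₁ (star w) x = w ∈V x
  Clique₁ spoke    x = fz ∈V x
  Clique₁ (rim a)  x = WithinEdge (fs a) (fs (next a)) x

  Clique₁-clash : ∀ {s x y} → Clique₁ s x → Clique₁ s y → Conflict x y
  Clique₁-clash {star _} = shared-vertex⇒Conflict
  Clique₁-clash {spoke}  = shared-vertex⇒Conflict
  Clique₁-clash {rim a}  = WithinEdge⇒Conflict (inj₁ (Succ-next a)) (inj₂ (Succ-next a))

  slots₁ : E → List Slot₁
  slots₁ (vtx fz)                          = []
  slots₁ (vtx (fs a))                      = star (fs a) ∷ rim a ∷ rim (prev a) ∷ []
  slots₁ (edg fz w _ _)                    = star fz ∷ spoke ∷ star w ∷ []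
  slots₁ (edg (fs _) fz _ _)               = []
  slots₁ (edg (fs a) (fs b) _ (inj₁ _))    = star (fs a) ∷ star (fs b) ∷ rim a ∷ []
  slots₁ (edg (fs a) (fs b) _ (inj₂ _))    = star (fs a) ∷ star (fs b) ∷ rim b ∷ []

  open CliqueCover (↔⇒↣ (↔-sym +↔⊎)) {Conflict} {Clique₁} (λ {s} → Clique₁-clash {s}) slots₁
    renaming (Covered to Covered₁; cover-bound to cover-bound₁)

  covered₁ : ∀ {x} → hub ≢ x → Covered₁ 3 x
  covered₁ {vtx fz} hub≢x = contradiction refl hub≢x
  covered₁ {vtx (fs a)} _ =
    (((λ ()) ∷ (λ ()) ∷ []) ∷ (a≢prev ∘ Fin.suc-injective ∘ inj₂-injective ∷ []) ∷ [] ∷ []) ,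
    ≤-refl ,
    (refl ∷ endpoint (inj₁ refl) ∷ endpoint (inj₂ (cong fs (sym (next-prev a)))) ∷ [])
    where
    a≢prev : a ≢ prev a
    a≢prev = Succ⇒≢ 2≤n (Succ-prev a) ∘ sym
  covered₁ {edg fz fz _ ()}
  covered₁ {edg fz (fs b) _ _} _ =
    (((λ ()) ∷ (λ ()) ∷ []) ∷ ((λ ()) ∷ []) ∷ [] ∷ []) ,
    ≤-refl ,
    (inj₁ refl ∷ inj₁ refl ∷ inj₂ refl ∷ [])
  covered₁ {edg (fs a) fz () _}
  covered₁ {edg (fs a) (fs b) a<b (inj₁ a→b)} _ =
    ((Fin.<⇒≢ a<b ∘ inj₁-injective ∷ (λ ()) ∷ []) ∷ ((λ ()) ∷ []) ∷ [] ∷ []) ,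
    ≤-refl ,
    (inj₁ refl ∷ inj₂ refl ∷ edge (inj₁ refl) (inj₂ (cong fs (Succ-functional (Succ-next a) a→b))) ∷ [])
  covered₁ {edg (fs a) (fs b) a<b (inj₂ b→a)} _ =
    ((Fin.<⇒≢ a<b ∘ inj₁-injective ∷ (λ ()) ∷ []) ∷ ((λ ()) ∷ []) ∷ [] ∷ []) ,
    ≤-refl ,
    (inj₁ refl ∷ inj₂ refl ∷ edge (inj₂ refl) (inj₁ (cong fs (Succ-functional (Succ-next b) b→a))) ∷ [])

  Slot₂ : Set
  Slot₂ = Fin n ⊎ Fin 2

  centre : Slot₂ → Fin (suc n)
  centre (inj₁ a) = fs a
  centre (inj₂ _) = fz

  Clique₂ : Slot₂ → E → Set
  Clique₂ s x = centre s ∈V x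

  slots₂ : E → List Slot₂
  slots₂ (vtx fz)                 = inj₂ fz ∷ inj₂ (fs fz) ∷ []
  slots₂ (edg (fs a) (fs b) _ _)  = inj₁ a ∷ inj₁ b ∷ []
  slots₂ _                        = []

  open CliqueCover (↔⇒↣ (↔-sym +↔⊎)) {Conflict} {Clique₂} shared-vertex⇒Conflict slots₂
    renaming (Covered to Covered₂; cover-bound to cover-bound₂)

  covered₂ : ∀ {x} → hub ≡ x ⊎ ¬ Conflict hub x → Covered₂ 2 x
  covered₂ (inj₁ refl) = (((λ ()) ∷ []) ∷ [] ∷ []) , ≤-refl , (refl ∷ refl ∷ [])
  covered₂ {vtx fz}        (inj₂ ¬c) = contradiction (inj₁ refl) ¬c
  covered₂ {vtx (fs _)}    (inj₂ ¬c) = contradiction (inj₂ _) ¬c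
  covered₂ {edg fz _ _ _}  (inj₂ ¬c) = contradiction (inj₁ refl) ¬c
  covered₂ {edg (fs _) fz () _}
  covered₂ {edg (fs a) (fs b) a<b _} _ =
    ((Fin.<⇒≢ a<b ∘ cong fs ∘ inj₁-injective ∷ []) ∷ [] ∷ []) , ≤-refl , (inj₁ refl ∷ inj₂ refl ∷ [])

  hub-free-bound : ∀ {L} → All (hub ≢_) L → IsMixedIndep L → 3 * length L ≤ 2 * n + 2
  hub-free-bound {L} hub∉L indep = begin
    3 * length L     ≤⟨ cover-bound₁ (All.map covered₁ hub∉L) indep ⟩
    suc n + suc n    ≡⟨ suc+suc≡2*+2 n ⟩
    2 * n + 2        ∎
    where open ≤-Reasoning

  hub-bound : ∀ {L} → hub ∈ L → IsMixedIndep L → 3 * length L ≤ 2 * n + 2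
  hub-bound {L} hub∈L indep =
    2*m≤n+2⇒3*m≤2*n+2 {length L} 2≤n (cover-bound₂ (All.map covered₂ compatible) indep)
    where
    compatible : All (λ y → hub ≡ y ⊎ ¬ Conflict hub y) L
    compatible = AllPairs-member (λ ¬c → ¬c ∘ Conflict-sym WheelAdj-sym) indep hub∈L

  upper-bound : ∀ {L} → IsMixedIndep L → length L ≤ ceil3 (2 * n)
  upper-bound {L} indep with any? hub? L
  ... | yes hub∈L = ceil3-greatest (2 * n) (hub-bound hub∈L indep)
  ... | no  hub∉L = ceil3-greatest (2 * n) (hub-free-bound (All.¬Any⇒All¬ L hub∉L) indep)

  rimEdge : (a b : Fin n) → toℕ b ≡ suc (toℕ a) → E
  rimEdge a b a→b = edg (fs a) (fs b) (s≤s (≤-reflexive (sym a→b))) (inj₁ (inj₁ a→b))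

  data RimAt : ℕ → E → Set where
    vertexAt : ∀ {j} (a : Fin n) → toℕ a ≡ j → RimAt (2 * j) (vtx (fs a))
    edgeAt   : ∀ {j} (a b : Fin n) (a→b : toℕ b ≡ suc (toℕ a)) → toℕ a ≡ j →
               RimAt (suc (2 * j)) (rimEdge a b a→b)

  rimElement : ∀ p → 2 + p ≤ 2 * n → Σ E (RimAt p)
  rimElement p 2+p≤ with half p
  ... | even j = vtx (fs (fromℕ< j<n)) , vertexAt _ (Fin.toℕ-fromℕ< j<n)
    where j<n : j < n
          j<n = *-cancelˡ-< 2 j n (<⇒≤ 2+p≤)
  ... | odd j = rimEdge a b a→b , edgeAt a b a→b (Fin.toℕ-fromℕ< j<n)
    where 1+j<n : suc j < n
          1+j<n = *-cancelˡ-< 2 (suc j) n (subst (_< 2 * n) (sym (*-suc 2 j)) 2+p≤)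
          j<n : j < n
          j<n = <-trans (n<1+n j) 1+j<n
          a b : Fin n
          a = fromℕ< j<n
          b = fromℕ< 1+j<n
          a→b : toℕ b ≡ suc (toℕ a)
          a→b = trans (Fin.toℕ-fromℕ< 1+j<n) (cong suc (sym (Fin.toℕ-fromℕ< j<n)))

  RimAt-∈V : ∀ {p x w} → RimAt p x → w ∈V x →
             ∃ λ a → w ≡ fs a × 2 * toℕ a ≤ suc p × p ≤ suc (2 * toℕ a)
  RimAt-∈V (vertexAt a refl) refl = a , refl , n≤1+n _ , n≤1+n _
  RimAt-∈V (edgeAt a b a→b refl) (inj₁ refl) = a , refl , m≤n+m _ 2 , ≤-refl
  RimAt-∈V (edgeAt a b a→b refl) (inj₂ refl) =
    b , refl , ≤-reflexive (trans (cong (2 *_) a→b) (*-suc 2 (toℕ a))) ,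
    s≤s (*-monoʳ-≤ 2 (≤-trans (n≤1+n _) (≤-reflexive (sym a→b))))

  -- 1 ≤ p rules out the wrap-around adjacency of rim vertex 0 with rim vertex n − 1.
  RimAt-adjacent⇒close : ∀ {p q u v} → RimAt p (vtx u) → RimAt q (vtx v) → 1 ≤ p →
                         WheelAdj n u v → q ≤ 2 + p
  RimAt-adjacent⇒close (vertexAt a refl) (vertexAt b refl) _ (inj₁ (inj₁ b≡1+a)) =
    ≤-reflexive (trans (cong (2 *_) b≡1+a) (*-suc 2 (toℕ a)))
  RimAt-adjacent⇒close (vertexAt a refl) (vertexAt b refl) _ (inj₁ (inj₂ (_ , b≡0))) =
    ≤-trans (≤-reflexive (cong (2 *_) b≡0)) z≤n
  RimAt-adjacent⇒close (vertexAt a refl) (vertexAt b refl) _ (inj₂ (inj₁ a≡1+b)) =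
    ≤-trans (*-monoʳ-≤ 2 (≤-trans (n≤1+n _) (≤-reflexive (sym a≡1+b)))) (m≤n+m _ 2)
  RimAt-adjacent⇒close (vertexAt a refl) (vertexAt b refl) 1≤p (inj₂ (inj₂ (_ , a≡0))) =
    contradiction (subst (1 ≤_) (cong (2 *_) a≡0) 1≤p) λ ()

  RimAt-Conflict⇒close : ∀ {p q x y} → RimAt p x → RimAt q y → 1 ≤ p → Conflict x y → q ≤ 2 + p
  RimAt-Conflict⇒close x-at y-at 1≤p c with Conflict⇒shared⊎adjacent c
  ... | inj₂ (_ , _ , refl , refl , uv) = RimAt-adjacent⇒close x-at y-at 1≤p uv
  ... | inj₁ (_ , w∈x , w∈y) with RimAt-∈V x-at w∈x | RimAt-∈V y-at w∈y
  ...   | a , refl , 2a≤1+p , _ | _ , refl , _ , q≤1+2a = ≤-trans q≤1+2a (s≤s 2a≤1+p)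

  first-spoke : E
  first-spoke = edg fz (fs fz) (s≤s z≤n) _

  first-spoke-compatible : ∀ {p y} → RimAt p y → 2 ≤ p → ¬ Conflict first-spoke y
  first-spoke-compatible y-at 2≤p c with Conflict⇒shared⊎adjacent c
  ... | inj₂ (_ , _ , () , _)
  ... | inj₁ (_ , w∈s , w∈y) with RimAt-∈V y-at w∈y | w∈s
  ...   | _ , refl , _ , _     | inj₁ ()
  ...   | _ , refl , _ , p≤1   | inj₂ refl = contradiction (≤-trans 2≤p p≤1) λ { (s≤s ()) }

  independent-set : ∀ K → 3 * suc K ≤ 2 * n + 2 →
                    Σ (List E) λ L → IsMixedIndep L × length L ≡ suc K
  independent-set K 3[K+1]≤ =
    first-spoke ∷ tabulate (proj₁ ∘ element) ,
    All.tabulate⁺ (λ i → first-spoke-compatible (proj₂ (element i)) (m≤m+n 2 _)) ∷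
      AllPairs.tabulate⁺-< (λ {i} {j} i<j c →
        ≤⇒≯ (RimAt-Conflict⇒close (proj₂ (element i)) (proj₂ (element j)) (s≤s z≤n) c) (spacing i<j)) ,
    cong suc (length-tabulate (proj₁ ∘ element))
    where
    position : Fin K → ℕ
    position i = 2 + 3 * toℕ i

    in-range : ∀ i → 2 + position i ≤ 2 * n
    in-range i = +-cancelˡ-≤ 2 _ _ (begin
      2 + (2 + position i)     ≡⟨ trans (*-suc 3 (suc (toℕ i))) (cong (3 +_) (*-suc 3 (toℕ i))) ⟨
      3 * suc (suc (toℕ i))    ≤⟨ *-monoʳ-≤ 3 (s≤s (Fin.toℕ<n i)) ⟩
      3 * suc K                ≤⟨ 3[K+1]≤ ⟩
      2 * n + 2                ≡⟨ +-comm (2 * n) 2 ⟩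
      2 + 2 * n                ∎)
      where open ≤-Reasoning

    element : (i : Fin K) → Σ E (RimAt (position i))
    element i = rimElement (position i) (in-range i)

    spacing : ∀ {i j} → toℕ i < toℕ j → 3 + position i ≤ position j
    spacing {i} {j} i<j = begin
      3 + position i          ≡⟨ cong (2 +_) (*-suc 3 (toℕ i)) ⟨
      2 + 3 * suc (toℕ i)     ≤⟨ +-monoʳ-≤ 2 (*-monoʳ-≤ 3 i<j) ⟩
      position j              ∎
      where open ≤-Reasoning

  lower-bound : Σ (List E) λ L → IsMixedIndep L × length L ≡ ceil3 (2 * n)
  lower-bound with ceil3 (2 * n) | ceil3-sound (2 * n) | ceil3-positive {2 * n} (s≤s z≤n)
  ... | suc K | 3c≤ | _ = independent-set K 3c≤

  mixedIndepNumber : MixedIndepNumberIs (WheelAdj n) (ceil3 (2 * n))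
  mixedIndepNumber = lower-bound , λ _ → upper-bound

lemma2p2 : (n : ℕ) → 3 ≤ n → MixedIndepNumberIs (WheelAdj n) (ceil3 (2 * n))
lemma2p2 1 (s≤s ())
lemma2p2 2 (s≤s (s≤s ()))
lemma2p2 (suc (suc (suc m))) _ = Wheel.mixedIndepNumber (suc m)
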